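{- Let $\pi$ be a Cayley permutation and write $\pi=B_1B_2\cdots B_k$, where each factor $B_t$ is a maximal weakly decreasing factor (so the last element of $B_t$ is strictly smaller than the first element of $B_{t+1}$). Then $\mathcal{HPS}(\pi)=\mathcal{R}(B_1)\cdots\mathcal{R}(B_k)$.
   Context: A Cayley permutation is a finite word $\pi=\pi_1\cdots\pi_n$ over the positive integers such that every integer from $1$ to $\max(\pi)$ occurs at least once. $\mathcal{R}$ denotes word reversal. A hare pop-stack processes an input from left to right with a right-greedy algorithm: while the input is nonempty, the next input element is pushed if the resulting stack contents, read from top to bottom, avoid the pattern $21$ (i.e. are weakly increasing from top to bottom); otherwise a pop operation is performed, which removes all elements of the stack, appending them to the output in order from top to bottom. When the input is exhausted, the stack is emptied in the same way. $\mathcal{HPS}(\pi)$ denotes the output on input $\pi$. -}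

module Defs where

open import Data.Nat using (ℕ; _≤_; _<_; _≥_; _≤?_)
open import Data.Nat.Properties using (≤-refl)
open import Data.List using (List; []; _∷_; _++_; _∷ʳ_; foldr)
open import Data.List.Membership.Propositional using (_∈_)
open import Data.List.Relation.Unary.All using (All)
open import Data.List.Relation.Unary.Linked using (Linked; linked?)
open import Data.Product using (∃; ∃₂; _×_)
open import Data.Nat using (_⊔_)
open import Relation.Binary.PropositionalEquality using (_≡_; _≢_)
open import Relation.Nullary using (yes; no)

maxW : List ℕ → ℕ
maxW = foldr _⊔_ 0

IsCayley : List ℕ → Set
IsCayley π = All (λ x → 1 ≤ x) π × (∀ i → 1 ≤ i → i ≤ maxW π → i ∈ π)

-- The stack is a list whose head is the top.
-- hpsRun stack input: if pushing x gives stack contents (top to bottom)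
-- avoiding 21 (weakly increasing), push; otherwise pop the whole stack
-- (top to bottom) to the output, after which x is pushed onto the
-- now-empty stack (the next iteration of the loop).
hpsRun : List ℕ → List ℕ → List ℕ
hpsRun st [] = st
hpsRun st (x ∷ xs) with linked? _≤?_ (x ∷ st)
... | yes _ = hpsRun (x ∷ st) xs
... | no  _ = st ++ hpsRun (x ∷ []) xs

HPS : List ℕ → List ℕ
HPS π = hpsRun [] π

WeaklyDecreasing : List ℕ → Set
WeaklyDecreasing = Linked _≥_

Ascent : List ℕ → List ℕ → Set
Ascent B C = ∃₂ λ a c → (∃ λ B' → B ≡ B' ∷ʳ a) × (∃ λ C' → C ≡ c ∷ C') × a < c

-- Bs is the factorisation of a word into maximal weakly decreasing factors:
-- nonempty, weakly decreasing factors with a strict ascent between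
-- consecutive factors (this makes each factor maximal).
IsMaxDecFactorisation : List (List ℕ) → Set
IsMaxDecFactorisation Bs =
  All (λ B → B ≢ []) Bs × All WeaklyDecreasing Bs × Linked Ascent Bs

module Submission where

open import Defs
open import Data.Nat using (ℕ; _≤_; _<_; _≥_; _≤?_)
open import Data.Nat.Properties using (<⇒≱)
open import Data.List using (List; []; _∷_; [_]; _++_; _∷ʳ_; _ʳ++_; concat; map; reverse)
open import Data.List.Properties using (++-identityʳ; reverse-++)
open import Data.List.Relation.Unary.All using (All; _∷_)
open import Data.List.Relation.Unary.Linked using (Linked; linked?; [-]; _∷_)
open import Data.Product using (_,_)
open import Data.Empty using (⊥-elim)
open import Relation.Nullary using (yes; no)
open import Relation.Binary.PropositionalEquality using (_≡_; refl; sym; cong; cong₂; module ≡-Reasoning)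

-- A weakly decreasing factor is pushed element by element, since each new
-- element is at most the current top; the first strict ascent forces a pop,
-- which outputs the stack, i.e. the reversed factor.

hpsRun-push : ∀ {x st} ys → Linked _≤_ (x ∷ st) → hpsRun st (x ∷ ys) ≡ hpsRun (x ∷ st) ys
hpsRun-push {x} {st} ys x∷st↑ with linked? _≤?_ (x ∷ st)
... | yes _ = refl
... | no ¬x∷st↑ = ⊥-elim (¬x∷st↑ x∷st↑)

hpsRun-pop : ∀ {a c} st ys → a < c → hpsRun (a ∷ st) (c ∷ ys) ≡ (a ∷ st) ++ hpsRun [] (c ∷ ys)
hpsRun-pop {a} {c} st ys a<c with linked? _≤?_ (c ∷ a ∷ st)
... | yes (c≤a ∷ _) = ⊥-elim (<⇒≱ a<c c≤a)
... | no _ = cong ((a ∷ st) ++_) (sym (hpsRun-push ys [-]))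

hpsRun-pushDecreasing : ∀ {x st} B ys → Linked _≤_ (x ∷ st) → Linked _≥_ (x ∷ B) →
                        hpsRun (x ∷ st) (B ++ ys) ≡ hpsRun (B ʳ++ (x ∷ st)) ys
hpsRun-pushDecreasing [] ys _ _ = refl
hpsRun-pushDecreasing {x} {st} (y ∷ B) ys x∷st↑ (y≤x ∷ y∷B↓) = begin
  hpsRun (x ∷ st) (y ∷ B ++ ys)  ≡⟨ hpsRun-push (B ++ ys) (y≤x ∷ x∷st↑) ⟩
  hpsRun (y ∷ x ∷ st) (B ++ ys)  ≡⟨ hpsRun-pushDecreasing B ys (y≤x ∷ x∷st↑) y∷B↓ ⟩
  hpsRun (B ʳ++ (y ∷ x ∷ st)) ys ∎
  where open ≡-Reasoning

hpsRun-decreasingPrefix : ∀ B ys → WeaklyDecreasing B → hpsRun [] (B ++ ys) ≡ hpsRun (reverse B) ys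
hpsRun-decreasingPrefix [] ys _ = refl
hpsRun-decreasingPrefix (b ∷ B) ys b∷B↓ = begin
  hpsRun [] (b ∷ B ++ ys)  ≡⟨ hpsRun-push (B ++ ys) [-] ⟩
  hpsRun [ b ] (B ++ ys)   ≡⟨ hpsRun-pushDecreasing B ys [-] b∷B↓ ⟩
  hpsRun (B ʳ++ [ b ]) ys  ∎
  where open ≡-Reasoning

HPS-concat-decreasing : ∀ Bs → All WeaklyDecreasing Bs → Linked Ascent Bs →
                        HPS (concat Bs) ≡ concat (map reverse Bs)
HPS-concat-decreasing [] _ _ = refl
HPS-concat-decreasing (B ∷ []) (B↓ ∷ _) _ = begin
  hpsRun [] (B ++ [])  ≡⟨ hpsRun-decreasingPrefix B [] B↓ ⟩
  reverse B            ≡⟨ ++-identityʳ (reverse B) ⟨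
  reverse B ++ []      ∎
  where open ≡-Reasoning
HPS-concat-decreasing (B ∷ C ∷ Bs) (B↓ ∷ Cs↓) ((a , c , (B′ , refl) , (C′ , refl) , a<c) ∷ Cs↗) = begin
  hpsRun [] (B ++ C ++ rest)                ≡⟨ hpsRun-decreasingPrefix B (C ++ rest) B↓ ⟩
  hpsRun (reverse B) (c ∷ C′ ++ rest)       ≡⟨ cong (λ st → hpsRun st (c ∷ C′ ++ rest)) reverse-B ⟩
  hpsRun (a ∷ reverse B′) (c ∷ C′ ++ rest)  ≡⟨ hpsRun-pop (reverse B′) (C′ ++ rest) a<c ⟩
  (a ∷ reverse B′) ++ HPS (C ++ rest)       ≡⟨ cong₂ _++_ (sym reverse-B) (HPS-concat-decreasing (C ∷ Bs) Cs↓ Cs↗) ⟩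
  reverse B ++ concat (map reverse (C ∷ Bs)) ∎
  where
  open ≡-Reasoning
  rest : List ℕ
  rest = concat Bs
  reverse-B : reverse (B′ ∷ʳ a) ≡ a ∷ reverse B′
  reverse-B = reverse-++ B′ [ a ]

lemma4 : (π : List ℕ) → IsCayley π → (Bs : List (List ℕ)) →
         IsMaxDecFactorisation Bs → concat Bs ≡ π →
         HPS π ≡ concat (map reverse Bs)
lemma4 _ _ Bs (_ , Bs↓ , Bs↗) refl = HPS-concat-decreasing Bs Bs↓ Bs↗
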